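{- Let $p \geq 1$ and $q \in \{2,3\}$ be integers, and consider $C_{2p+1} \square C_{2q}$ with vertices $v_{i,j}$ as described in the context. Let $B_1 = (v_{p,2q-1}, v_{p,q-1})$. Then for every $i \in \{0,1,\ldots,2p\}$ and $j \in \{0,1,\ldots,2q-1\}$, the set of vertices whose distance vector to $B_1$ equals that of $v_{i,j}$ is exactly $O_{i,j} = \{v_{i,j}, v_{2p-i,j}, v_{i,2q-2-j}, v_{2p-i,2q-2-j}\}$ (indices taken modulo $2p+1$ and $2q$ respectively); that is, all safe sets for $B_1$ are of this form. Moreover, the set $R_1 = \{v_{x,y} : x \in \{0,1,\ldots,p\},\ y \in \{q-1,q,\ldots,2q-1\}\}$ is a cop house for $B_1$.
   Context: $C_{2p+1}\square C_{2q}$ is the Cartesian product of the cycles of orders $2p+1$ and $2q$. Its vertices are labelled $v_{i,j}$ with $i$ taken modulo $2p+1$ and $j$ taken modulo $2q$, where $v_{i,j}$ is adjacent exactly to $v_{i\pm1,j}$ and $v_{i,j\pm1}$. For an ordered probe $B=(b_1,b_2)$ and a vertex $v$, the distance vector is $\vec D(B,v)=[d(v,b_1),d(v,b_2)]$. A vertex is safe if some other vertex has the same distance vector; a safe set is a set of vertices all having the same distance vector to $B$. A cop house for $B$ is a set of vertices no two distinct members of which have the same distance vector to $B$. -}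

module Defs where

open import Data.Nat using (ℕ; zero; suc; _+_; _*_; _∸_; _≤_)
open import Data.Fin using (Fin; toℕ)
open import Data.Product using (_×_; _,_; proj₁; proj₂; ∃-syntax)
open import Data.Sum using (_⊎_)
open import Relation.Binary.PropositionalEquality using (_≡_)

-- Vertex set of C_{2p+1} □ C_{2q}: v_{i,j} is the pair (i , j).
Vertex : ℕ → ℕ → Set
Vertex p q = Fin (suc (2 * p)) × Fin (2 * q)

Step : (n : ℕ) → Fin n → Fin n → Set
Step n a b = (suc (toℕ a) ≡ toℕ b) ⊎ (suc (toℕ a) ≡ n × toℕ b ≡ 0)

CAdj : (n : ℕ) → Fin n → Fin n → Set
CAdj n a b = Step n a b ⊎ Step n b a

Adj : (p q : ℕ) → Vertex p q → Vertex p q → Set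
Adj p q (i , j) (i' , j') =
  (CAdj (suc (2 * p)) i i' × j ≡ j') ⊎ (i ≡ i' × CAdj (2 * q) j j')

data Walk (p q : ℕ) : Vertex p q → Vertex p q → ℕ → Set where
  here : ∀ {u} → Walk p q u u 0
  step : ∀ {u v w k} → Adj p q u v → Walk p q v w k → Walk p q u w (suc k)

Dist : (p q : ℕ) → Vertex p q → Vertex p q → ℕ → Set
Dist p q u v k = Walk p q u v k × (∀ m → Walk p q u v m → k ≤ m)

SameDV : (p q : ℕ) → Vertex p q × Vertex p q → Vertex p q → Vertex p q → Set
SameDV p q (b₁ , b₂) u w =
  ∃[ k₁ ] ∃[ k₂ ] ((Dist p q u b₁ k₁ × Dist p q w b₁ k₁) ×
                   (Dist p q u b₂ k₂ × Dist p q w b₂ k₂))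

-- membership of w in O_{i,j} = {v_{i,j}, v_{2p-i,j}, v_{i,2q-2-j}, v_{2p-i,2q-2-j}}
-- first coordinate: x = i or x = 2p - i
-- second coordinate: y = j or y ≡ 2q-2-j (mod 2q), i.e. y + j + 2 ∈ {2q, 4q}
MirrorI : (p : ℕ) → Fin (suc (2 * p)) → Fin (suc (2 * p)) → Set
MirrorI p i x = toℕ x + toℕ i ≡ 2 * p

MirrorJ : (q : ℕ) → Fin (2 * q) → Fin (2 * q) → Set
MirrorJ q j y = (toℕ y + toℕ j + 2 ≡ 2 * q) ⊎ (toℕ y + toℕ j + 2 ≡ 4 * q)

InO : (p q : ℕ) → Vertex p q → Vertex p q → Set
InO p q (i , j) (x , y) =
  ((x ≡ i) × (y ≡ j)) ⊎
  (MirrorI p i x × (y ≡ j)) ⊎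
  ((x ≡ i) × MirrorJ q j y) ⊎
  (MirrorI p i x × MirrorJ q j y)

InR₁ : (p q : ℕ) → Vertex p q → Set
InR₁ p q (x , y) = toℕ x ≤ p × (q ∸ 1) ≤ toℕ y

CopHouse : (p q : ℕ) → Vertex p q × Vertex p q → (Vertex p q → Set) → Set
CopHouse p q B S = ∀ u w → S u → S w → SameDV p q B u w → u ≡ w

-- The distance from v_{i,j} to a probe v_{p,t} is |i - p| (p is the centre of the odd cycle, so no
-- wrap-around is shorter) plus the cycle distance from j to t. The probe columns 2q-1 and q-1 are
-- antipodal, so their column distances always sum to q; adding the two entries of a distance vector
-- therefore recovers |i - p|, and with it the distance to column 2q-1. Each of these two quantities
-- is shared exactly by a coordinate and its mirror image (i ↦ 2p-i, j ↦ 2q-2-j), which yields the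
-- safe sets O_{i,j}; on R₁ neither mirror identifies two coordinates, so R₁ is a cop house.
-- For q ∈ {2,3} the facts about the columns are decided by evaluation.
module Submission where

open import Defs
open import Data.Nat using (ℕ; zero; suc; _+_; _*_; _∸_; _≤_; s≤s; ∣_-_∣; _≟_; _≤?_)
open import Data.Nat.Properties
open import Data.Nat.Tactic.RingSolver using (solve-∀)
open import Data.Fin using (Fin; toℕ; fromℕ<; #_) renaming (_≟_ to _≟ᶠ_)
open import Data.Fin.Properties using (toℕ-injective; toℕ-fromℕ<; toℕ<n; all?; any?)
open import Data.Vec using (_∷_; []; lookup)
open import Data.Product using (_×_; _,_; proj₁; proj₂; ∃-syntax)
open import Data.Product.Function.NonDependent.Propositional using (_×-⇔_)
open import Data.Sum using (_⊎_; inj₁; inj₂; map₁)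
open import Function.Bundles using (_⇔_; mk⇔; Equivalence)
open import Function.Construct.Composition using (_⇔-∘_)
open import Function.Construct.Symmetry using (⇔-sym)
open import Relation.Nullary.Decidable using (Dec; True; toWitness; _⊎-dec_; _×-dec_; _→-dec_)
open import Relation.Binary.PropositionalEquality
  using (_≡_; refl; sym; trans; cong; cong₂; subst; module ≡-Reasoning)

open Equivalence using (to)

record DistanceTo {A : Set} (_~_ : A → A → Set) (t : A) : Set where
  field
    δ         : A → ℕ
    δ-adj     : ∀ a b → a ~ b → δ a ≤ suc (δ b)
    δ-descent : ∀ a k → δ a ≡ suc k → ∃[ b ] (a ~ b × δ b ≡ k)
    δ≡0⇒≡t    : ∀ a → δ a ≡ 0 → a ≡ t
    δ-t       : δ t ≡ 0

module _ {p q : ℕ} {b : Vertex p q} (D : DistanceTo (Adj p q) b) where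
  open DistanceTo D

  walk-of-length-δ : ∀ k u → δ u ≡ k → Walk p q u b k
  walk-of-length-δ zero u δu≡0 with refl ← δ≡0⇒≡t u δu≡0 = here
  walk-of-length-δ (suc k) u δu≡1+k with v , u~v , δv≡k ← δ-descent u k δu≡1+k =
    step u~v (walk-of-length-δ k v δv≡k)

  δ≤length : ∀ {u k} → Walk p q u b k → δ u ≤ k
  δ≤length here                    = ≤-reflexive δ-t
  δ≤length (step {u} {v} u~v walk) = ≤-trans (δ-adj u v u~v) (s≤s (δ≤length walk))

  δ-Dist : ∀ u → Dist p q u b (δ u)
  δ-Dist u = walk-of-length-δ (δ u) u refl , λ _ → δ≤length

productDistance : ∀ p q {ti tj} →
                  DistanceTo (CAdj (suc (2 * p))) ti → DistanceTo (CAdj (2 * q)) tj →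
                  DistanceTo (Adj p q) (ti , tj)
productDistance p q R C = record
  { δ = λ (i , j) → R.δ i + C.δ j ; δ-adj = adj ; δ-descent = descent
  ; δ≡0⇒≡t = λ (i , j) e → cong₂ _,_ (R.δ≡0⇒≡t i (m+n≡0⇒m≡0 (R.δ i) e))
                                      (C.δ≡0⇒≡t j (m+n≡0⇒n≡0 (R.δ i) e))
  ; δ-t = cong₂ _+_ R.δ-t C.δ-t }
  where
  module R = DistanceTo R
  module C = DistanceTo C

  adj : ∀ u v → Adj p q u v →
        R.δ (proj₁ u) + C.δ (proj₂ u) ≤ suc (R.δ (proj₁ v) + C.δ (proj₂ v))
  adj (i , j) (i′ , j) (inj₁ (i~i′ , refl)) = +-monoˡ-≤ (C.δ j) (R.δ-adj i i′ i~i′)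
  adj (i , j) (i , j′) (inj₂ (refl , j~j′)) =
    ≤-trans (+-monoʳ-≤ (R.δ i) (C.δ-adj j j′ j~j′)) (≤-reflexive (+-suc (R.δ i) (C.δ j′)))

  descent : ∀ u k → R.δ (proj₁ u) + C.δ (proj₂ u) ≡ suc k →
            ∃[ v ] (Adj p q u v × R.δ (proj₁ v) + C.δ (proj₂ v) ≡ k)
  descent (i , j) k e with R.δ i in δi
  ... | zero with j′ , j~j′ , δj′≡k ← C.δ-descent j k e =
    (i , j′) , inj₂ (refl , j~j′) , trans (cong (_+ C.δ j′) δi) δj′≡k
  ... | suc m with i′ , i~i′ , δi′≡m ← R.δ-descent i m δi =
    (i′ , j) , inj₁ (i~i′ , refl) , trans (cong (_+ C.δ j) δi′≡m) (suc-injective e)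

Dist-functional : ∀ {p q u v k k′} → Dist p q u v k → Dist p q u v k′ → k ≡ k′
Dist-functional (walk , minimal) (walk′ , minimal′) = ≤-antisym (minimal _ walk′) (minimal′ _ walk)

SameDV⇔≡δ : ∀ {p q b₁ b₂ v w} (D₁ : DistanceTo (Adj p q) b₁) (D₂ : DistanceTo (Adj p q) b₂) →
            SameDV p q (b₁ , b₂) v w ⇔
            (DistanceTo.δ D₁ v ≡ DistanceTo.δ D₁ w × DistanceTo.δ D₂ v ≡ DistanceTo.δ D₂ w)
SameDV⇔≡δ {p} {q} {v = v} {w} D₁ D₂ = mk⇔
  (λ (_ , _ , (v₁ , w₁) , (v₂ , w₂)) → same D₁ v₁ w₁ , same D₂ v₂ w₂)
  (λ (e₁ , e₂) → DistanceTo.δ D₁ v , DistanceTo.δ D₂ v ,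
    (δ-Dist D₁ v , subst (Dist _ _ w _) (sym e₁) (δ-Dist D₁ w)) ,
    (δ-Dist D₂ v , subst (Dist _ _ w _) (sym e₂) (δ-Dist D₂ w)))
  where
  same : ∀ {b k} (D : DistanceTo (Adj p q) b) → Dist p q v b k → Dist p q w b k →
         DistanceTo.δ D v ≡ DistanceTo.δ D w
  same D dv dw = trans (Dist-functional (δ-Dist D v) dv) (Dist-functional dw (δ-Dist D w))

[a+b]+[a+c]≡2a+[b+c] : ∀ a b c → (a + b) + (a + c) ≡ 2 * a + (b + c)
[a+b]+[a+c]≡2a+[b+c] = solve-∀

+-cancel-by-sums : ∀ {a b c a′ b′ c′} →
                   a + b ≡ a′ + b′ → a + c ≡ a′ + c′ → b + c ≡ b′ + c′ → a ≡ a′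
+-cancel-by-sums {a} {b} {c} {a′} {b′} {c′} e₁ e₂ e₃ =
  *-cancelˡ-≡ a a′ 2 (+-cancelʳ-≡ (b + c) (2 * a) (2 * a′) doubled)
  where
  open ≡-Reasoning
  doubled : 2 * a + (b + c) ≡ 2 * a′ + (b + c)
  doubled = begin
    2 * a + (b + c)         ≡⟨ [a+b]+[a+c]≡2a+[b+c] a b c ⟨
    (a + b) + (a + c)       ≡⟨ cong₂ _+_ e₁ e₂ ⟩
    (a′ + b′) + (a′ + c′)   ≡⟨ [a+b]+[a+c]≡2a+[b+c] a′ b′ c′ ⟩
    2 * a′ + (b′ + c′)      ≡⟨ cong (2 * a′ +_) e₃ ⟨
    2 * a′ + (b + c)        ∎

∣m-n∣-cases : ∀ m n → m + ∣ m - n ∣ ≡ n ⊎ m ≡ n + ∣ m - n ∣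
∣m-n∣-cases m n with ≤-total m n
... | inj₁ m≤n = inj₁ (trans (cong (m +_) (m≤n⇒∣m-n∣≡n∸m m≤n)) (m+[n∸m]≡n m≤n))
... | inj₂ n≤m = inj₂ (sym (trans (cong (n +_) (m≤n⇒∣n-m∣≡n∸m n≤m)) (m+[n∸m]≡n n≤m)))

m+k≡n⇒∣m-n∣≡k : ∀ {m n k} → m + k ≡ n → ∣ m - n ∣ ≡ k
m+k≡n⇒∣m-n∣≡k {m} {k = k} refl = ∣m-m+n∣≡n m k

∣n+k-n∣≡k : ∀ n k → ∣ n + k - n ∣ ≡ k
∣n+k-n∣≡k n k = trans (∣-∣-comm (n + k) n) (∣m-m+n∣≡n n k)

∣m-1+m∣≡1 : ∀ m → ∣ m - suc m ∣ ≡ 1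
∣m-1+m∣≡1 m = m+k≡n⇒∣m-n∣≡k (+-comm m 1)

∣m-n∣≤1+∣1+m-n∣ : ∀ m n → ∣ m - n ∣ ≤ suc ∣ suc m - n ∣
∣m-n∣≤1+∣1+m-n∣ m n = ≤-trans (∣-∣-triangle m (suc m) n)
  (≤-reflexive (cong (_+ ∣ suc m - n ∣) (∣m-1+m∣≡1 m)))

∣1+m-n∣≤1+∣m-n∣ : ∀ m n → ∣ suc m - n ∣ ≤ suc ∣ m - n ∣
∣1+m-n∣≤1+∣m-n∣ m n = ≤-trans (∣-∣-triangle (suc m) m n)
  (≤-reflexive (cong (_+ ∣ m - n ∣) (trans (∣-∣-comm (suc m) m) (∣m-1+m∣≡1 m))))

∣m-n∣-descent : ∀ m n k → ∣ m - n ∣ ≡ suc k →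
                (suc m ≤ n × ∣ suc m - n ∣ ≡ k) ⊎ ∃[ m′ ] (suc m′ ≡ m × ∣ m′ - n ∣ ≡ k)
∣m-n∣-descent m n k e with ∣m-n∣-cases m n
... | inj₁ m+d≡n =
  inj₁ (≤-trans (m≤m+n (suc m) k) (≤-reflexive 1+m+k≡n) , m+k≡n⇒∣m-n∣≡k 1+m+k≡n)
  where
  1+m+k≡n : suc m + k ≡ n
  1+m+k≡n = trans (sym (+-suc m k)) (trans (cong (m +_) (sym e)) m+d≡n)
... | inj₂ m≡n+d =
  inj₂ (n + k , sym (trans m≡n+d (trans (cong (n +_) e) (+-suc n k))) , ∣n+k-n∣≡k n k)

m+d+d+m≡2*[m+d] : ∀ m d → m + d + d + m ≡ 2 * (m + d)
m+d+d+m≡2*[m+d] = solve-∀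

∣m-n∣≡∣o-n∣⇔ : ∀ m n o → ∣ m - n ∣ ≡ ∣ o - n ∣ ⇔ (o ≡ m ⊎ o + m ≡ 2 * n)
∣m-n∣≡∣o-n∣⇔ m n o = mk⇔
  (λ e → fibre (∣m-n∣-cases m n) (subst (λ d → o + d ≡ n ⊎ o ≡ n + d) (sym e) (∣m-n∣-cases o n)))
  (λ where (inj₁ refl) → refl ; (inj₂ o+m≡2n) → mirror o+m≡2n)
  where
  opposite-sides : ∀ {m o d} → m + d ≡ n → o ≡ n + d → o + m ≡ 2 * n
  opposite-sides {m} {d = d} refl refl = m+d+d+m≡2*[m+d] m d

  fibre : ∀ {d} → m + d ≡ n ⊎ m ≡ n + d → o + d ≡ n ⊎ o ≡ n + d → o ≡ m ⊎ o + m ≡ 2 * n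
  fibre {d} (inj₁ m+d≡n) (inj₁ o+d≡n) = inj₁ (+-cancelʳ-≡ d o m (trans o+d≡n (sym m+d≡n)))
  fibre (inj₂ m≡n+d) (inj₂ o≡n+d) = inj₁ (trans o≡n+d (sym m≡n+d))
  fibre (inj₁ m+d≡n) (inj₂ o≡n+d) = inj₂ (opposite-sides m+d≡n o≡n+d)
  fibre (inj₂ m≡n+d) (inj₁ o+d≡n) = inj₂ (trans (+-comm o m) (opposite-sides o+d≡n m≡n+d))

  mirror : o + m ≡ 2 * n → ∣ m - n ∣ ≡ ∣ o - n ∣
  mirror o+m≡2n = begin
    ∣ m - n ∣                 ≡⟨ ∣m+n-m+o∣≡∣n-o∣ o m n ⟨
    ∣ o + m - o + n ∣         ≡⟨ cong₂ ∣_-_∣ o+m≡2n (+-comm o n) ⟩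
    ∣ n + (n + 0) - n + o ∣   ≡⟨ cong (λ n′ → ∣ n + n′ - n + o ∣) (+-identityʳ n) ⟩
    ∣ n + n - n + o ∣         ≡⟨ ∣m+n-m+o∣≡∣n-o∣ n n o ⟩
    ∣ n - o ∣                 ≡⟨ ∣-∣-comm n o ⟩
    ∣ o - n ∣                 ∎
    where open ≡-Reasoning

∣m-n∣≡∣o-n∣⇒m≡o : ∀ {m n o} → m ≤ n → o ≤ n → ∣ m - n ∣ ≡ ∣ o - n ∣ → m ≡ o
∣m-n∣≡∣o-n∣⇒m≡o m≤n o≤n e =
  ∸-cancelˡ-≡ m≤n o≤n (trans (sym (m≤n⇒∣m-n∣≡n∸m m≤n)) (trans e (m≤n⇒∣m-n∣≡n∸m o≤n)))

centreDistance : ∀ p (t : Fin (suc (2 * p))) → toℕ t ≡ p → DistanceTo (CAdj (suc (2 * p))) t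
centreDistance p t toℕt≡p = record
  { δ = ρ ; δ-adj = adj ; δ-descent = descent
  ; δ≡0⇒≡t = λ a e → toℕ-injective (trans (∣m-n∣≡0⇒m≡n e) (sym toℕt≡p))
  ; δ-t = trans (cong ∣_- p ∣ toℕt≡p) (∣n-n∣≡0 p) }
  where
  ρ : Fin (suc (2 * p)) → ℕ
  ρ a = ∣ toℕ a - p ∣

  ∣2p-p∣≡p : ∣ 2 * p - p ∣ ≡ p
  ∣2p-p∣≡p = trans (cong (λ p′ → ∣ p + p′ - p ∣) (+-identityʳ p)) (∣n+k-n∣≡k p p)

  ρ-step : ∀ a b → Step (suc (2 * p)) a b → ρ a ≤ suc (ρ b) × ρ b ≤ suc (ρ a)
  ρ-step a b (inj₁ 1+a≡b) rewrite sym 1+a≡b =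
    ∣m-n∣≤1+∣1+m-n∣ (toℕ a) p , ∣1+m-n∣≤1+∣m-n∣ (toℕ a) p
  ρ-step a b (inj₂ (1+a≡1+2p , b≡0)) rewrite suc-injective 1+a≡1+2p | b≡0 | ∣2p-p∣≡p =
    n≤1+n p , n≤1+n p

  adj : ∀ a b → CAdj (suc (2 * p)) a b → ρ a ≤ suc (ρ b)
  adj a b (inj₁ a→b) = proj₁ (ρ-step a b a→b)
  adj a b (inj₂ b→a) = proj₂ (ρ-step b a b→a)

  descent : ∀ a k → ρ a ≡ suc k → ∃[ b ] (CAdj (suc (2 * p)) a b × ρ b ≡ k)
  descent a k e with ∣m-n∣-descent (toℕ a) p k e
  ... | inj₁ (1+a≤p , ρ[1+a]≡k) =
    b , inj₁ (inj₁ (sym (toℕ-fromℕ< 1+a<1+2p))) ,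
    trans (cong ∣_- p ∣ (toℕ-fromℕ< 1+a<1+2p)) ρ[1+a]≡k
    where
    1+a<1+2p = s≤s (≤-trans 1+a≤p (m≤m+n p (p + 0)))
    b = fromℕ< 1+a<1+2p
  ... | inj₂ (m , 1+m≡a , ρm≡k) =
    b , inj₂ (inj₁ (trans (cong suc (toℕ-fromℕ< m<1+2p)) 1+m≡a)) ,
    trans (cong ∣_- p ∣ (toℕ-fromℕ< m<1+2p)) ρm≡k
    where
    m<1+2p = ≤-trans (n≤1+n (suc m)) (≤-trans (≤-reflexive (cong suc 1+m≡a)) (toℕ<n a))
    b = fromℕ< m<1+2p

centre-mirror : ∀ {p} (i x : Fin (suc (2 * p))) →
                ∣ toℕ i - p ∣ ≡ ∣ toℕ x - p ∣ ⇔ (x ≡ i ⊎ MirrorI p i x)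
centre-mirror {p} i x =
  mk⇔ (map₁ toℕ-injective) (map₁ (cong toℕ)) ⇔-∘ ∣m-n∣≡∣o-n∣⇔ (toℕ i) p (toℕ x)

step? : ∀ {n} (a b : Fin n) → Dec (Step n a b)
step? {n} a b = (suc (toℕ a) ≟ toℕ b) ⊎-dec ((suc (toℕ a) ≟ n) ×-dec (toℕ b ≟ 0))

cadj? : ∀ {n} (a b : Fin n) → Dec (CAdj n a b)
cadj? a b = step? a b ⊎-dec step? b a

mirrorJ? : ∀ q (j y : Fin (2 * q)) → Dec (MirrorJ q j y)
mirrorJ? q j y = (toℕ y + toℕ j + 2 ≟ 2 * q) ⊎-dec (toℕ y + toℕ j + 2 ≟ 4 * q)

decideDistance : ∀ {n} (t : Fin n) (d : Fin n → ℕ) →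
  {True (all? λ a → all? λ b → cadj? a b →-dec (d a ≤? suc (d b)))} →
  {True (all? λ a → (d a ≟ 0) ⊎-dec any? λ b → cadj? a b ×-dec (suc (d b) ≟ d a))} →
  {True (all? λ a → (d a ≟ 0) →-dec (a ≟ᶠ t))} →
  {True (d t ≟ 0)} →
  DistanceTo (CAdj n) t
decideDistance {n} t d {adj} {zero-or-descent} {zero⇒t} {zero-at-t} = record
  { δ = d ; δ-adj = toWitness adj ; δ-descent = descent
  ; δ≡0⇒≡t = toWitness zero⇒t ; δ-t = toWitness zero-at-t }
  where
  descent : ∀ a k → d a ≡ suc k → ∃[ b ] (CAdj n a b × d b ≡ k)
  descent a k e with toWitness zero-or-descent a
  ... | inj₁ da≡0 with () ← trans (sym e) da≡0
  ... | inj₂ (b , a~b , 1+db≡da) = b , a~b , suc-injective (trans 1+db≡da e)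

record ProbeColumns (q : ℕ) : Set where
  field
    {col₁ col₂}        : Fin (2 * q)
    toℕ-col₁           : toℕ col₁ ≡ 2 * q ∸ 1
    toℕ-col₂           : toℕ col₂ ≡ q ∸ 1
    to-col₁            : DistanceTo (CAdj (2 * q)) col₁
    to-col₂            : DistanceTo (CAdj (2 * q)) col₂
    antipodal          : ∀ j → DistanceTo.δ to-col₁ j + DistanceTo.δ to-col₂ j ≡ q
    δ₁-fibre           : ∀ j y → DistanceTo.δ to-col₁ j ≡ DistanceTo.δ to-col₁ y ⇔
                                 (y ≡ j ⊎ MirrorJ q j y)
    δ₁-injective-upper : ∀ j y → q ∸ 1 ≤ toℕ j → q ∸ 1 ≤ toℕ y →
                         DistanceTo.δ to-col₁ j ≡ DistanceTo.δ to-col₁ y → j ≡ y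

decideProbeColumns : ∀ {q c₁ c₂} → toℕ c₁ ≡ 2 * q ∸ 1 → toℕ c₂ ≡ q ∸ 1 →
  (D₁ : DistanceTo (CAdj (2 * q)) c₁) (D₂ : DistanceTo (CAdj (2 * q)) c₂) →
  let δ₁ = DistanceTo.δ D₁ ; δ₂ = DistanceTo.δ D₂ in
  {True (all? λ j → δ₁ j + δ₂ j ≟ q)} →
  {True (all? λ j → all? λ y → (δ₁ j ≟ δ₁ y) →-dec ((y ≟ᶠ j) ⊎-dec mirrorJ? q j y))} →
  {True (all? λ j → all? λ y → mirrorJ? q j y →-dec (δ₁ j ≟ δ₁ y))} →
  {True (all? λ j → all? λ y →
           (q ∸ 1 ≤? toℕ j) →-dec ((q ∸ 1 ≤? toℕ y) →-dec ((δ₁ j ≟ δ₁ y) →-dec (j ≟ᶠ y))))} →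
  ProbeColumns q
decideProbeColumns e₁ e₂ D₁ D₂ {antipodal} {fibre⇒} {fibre⇐} {injective} = record
  { toℕ-col₁ = e₁ ; toℕ-col₂ = e₂ ; to-col₁ = D₁ ; to-col₂ = D₂
  ; antipodal = toWitness antipodal
  ; δ₁-fibre = λ j y → mk⇔ (toWitness fibre⇒ j y) λ where
      (inj₁ refl)   → refl
      (inj₂ mirror) → toWitness fibre⇐ j y mirror
  ; δ₁-injective-upper = toWitness injective }

probeColumns₂ : ProbeColumns 2
probeColumns₂ = decideProbeColumns refl refl
  (decideDistance (# 3) (lookup (1 ∷ 2 ∷ 1 ∷ 0 ∷ [])))
  (decideDistance (# 1) (lookup (1 ∷ 0 ∷ 1 ∷ 2 ∷ [])))

probeColumns₃ : ProbeColumns 3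
probeColumns₃ = decideProbeColumns refl refl
  (decideDistance (# 5) (lookup (1 ∷ 2 ∷ 3 ∷ 2 ∷ 1 ∷ 0 ∷ [])))
  (decideDistance (# 2) (lookup (2 ∷ 1 ∷ 0 ∷ 1 ∷ 2 ∷ 3 ∷ [])))

InO⇔ : ∀ {p q i j x y} →
       InO p q (i , j) (x , y) ⇔ ((x ≡ i ⊎ MirrorI p i x) × (y ≡ j ⊎ MirrorJ q j y))
InO⇔ = mk⇔ split merge
  where
  split = λ where
    (inj₁ (x≡i , y≡j))               → inj₁ x≡i , inj₁ y≡j
    (inj₂ (inj₁ (x~i , y≡j)))        → inj₂ x~i , inj₁ y≡j
    (inj₂ (inj₂ (inj₁ (x≡i , y~j)))) → inj₁ x≡i , inj₂ y~j
    (inj₂ (inj₂ (inj₂ (x~i , y~j)))) → inj₂ x~i , inj₂ y~j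
  merge = λ where
    (inj₁ x≡i , inj₁ y≡j) → inj₁ (x≡i , y≡j)
    (inj₂ x~i , inj₁ y≡j) → inj₂ (inj₁ (x~i , y≡j))
    (inj₁ x≡i , inj₂ y~j) → inj₂ (inj₂ (inj₁ (x≡i , y~j)))
    (inj₂ x~i , inj₂ y~j) → inj₂ (inj₂ (inj₂ (x~i , y~j)))

module SafeSets {p q : ℕ} (C : ProbeColumns q) (i₁ i₂ : Fin (suc (2 * p)))
                (toℕ-i₁ : toℕ i₁ ≡ p) (toℕ-i₂ : toℕ i₂ ≡ p) where
  open ProbeColumns C

  B : Vertex p q × Vertex p q
  B = (i₁ , col₁) , (i₂ , col₂)

  ρ : Fin (suc (2 * p)) → ℕ
  ρ a = ∣ toℕ a - p ∣

  δ₁ δ₂ : Fin (2 * q) → ℕ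
  δ₁ = DistanceTo.δ to-col₁
  δ₂ = DistanceTo.δ to-col₂

  to-b₁ : DistanceTo (Adj p q) (i₁ , col₁)
  to-b₁ = productDistance p q (centreDistance p i₁ toℕ-i₁) to-col₁

  to-b₂ : DistanceTo (Adj p q) (i₂ , col₂)
  to-b₂ = productDistance p q (centreDistance p i₂ toℕ-i₂) to-col₂

  SameDV⇔same-ρ-δ₁ : ∀ i j x y → SameDV p q B (i , j) (x , y) ⇔ (ρ i ≡ ρ x × δ₁ j ≡ δ₁ y)
  SameDV⇔same-ρ-δ₁ i j x y = mk⇔ separate combine ⇔-∘ SameDV⇔≡δ to-b₁ to-b₂
    where
    separate : ρ i + δ₁ j ≡ ρ x + δ₁ y × ρ i + δ₂ j ≡ ρ x + δ₂ y → ρ i ≡ ρ x × δ₁ j ≡ δ₁ y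
    separate (e₁ , e₂) =
      ρi≡ρx , +-cancelˡ-≡ (ρ i) (δ₁ j) (δ₁ y) (trans e₁ (cong (_+ δ₁ y) (sym ρi≡ρx)))
      where
      ρi≡ρx = +-cancel-by-sums e₁ e₂ (trans (antipodal j) (sym (antipodal y)))

    combine : ρ i ≡ ρ x × δ₁ j ≡ δ₁ y → ρ i + δ₁ j ≡ ρ x + δ₁ y × ρ i + δ₂ j ≡ ρ x + δ₂ y
    combine (ρi≡ρx , δ₁j≡δ₁y) = cong₂ _+_ ρi≡ρx δ₁j≡δ₁y , cong₂ _+_ ρi≡ρx δ₂j≡δ₂y
      where
      δ₂j≡δ₂y = +-cancelˡ-≡ (δ₁ j) (δ₂ j) (δ₂ y)
                  (trans (antipodal j) (sym (trans (cong (_+ δ₂ y) δ₁j≡δ₁y) (antipodal y))))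

  safe-sets : ∀ v w → SameDV p q B v w ⇔ InO p q v w
  safe-sets (i , j) (x , y) =
    ⇔-sym (InO⇔ {p} {q}) ⇔-∘ ((centre-mirror i x ×-⇔ δ₁-fibre j y) ⇔-∘ SameDV⇔same-ρ-δ₁ i j x y)

  cop-house : CopHouse p q B (InR₁ p q)
  cop-house (i , j) (x , y) (i≤p , j-upper) (x≤p , y-upper) same
    with ρi≡ρx , δ₁j≡δ₁y ← to (SameDV⇔same-ρ-δ₁ i j x y) same =
    cong₂ _,_ (toℕ-injective (∣m-n∣≡∣o-n∣⇒m≡o i≤p x≤p ρi≡ρx))
              (δ₁-injective-upper j y j-upper y-upper δ₁j≡δ₁y)

probeColumns : ∀ {q} → q ≡ 2 ⊎ q ≡ 3 → ProbeColumns q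
probeColumns (inj₁ refl) = probeColumns₂
probeColumns (inj₂ refl) = probeColumns₃

lemma5p13 : (p q : ℕ) → 1 ≤ p → (q ≡ 2 ⊎ q ≡ 3) →
    (b₁ b₂ : Vertex p q) →
    toℕ (proj₁ b₁) ≡ p → toℕ (proj₂ b₁) ≡ 2 * q ∸ 1 →
    toℕ (proj₁ b₂) ≡ p → toℕ (proj₂ b₂) ≡ q ∸ 1 →
    ((v w : Vertex p q) → (SameDV p q (b₁ , b₂) v w ⇔ InO p q v w))
    × CopHouse p q (b₁ , b₂) (InR₁ p q)
lemma5p13 p q _ q∈ (i₁ , j₁) (i₂ , j₂) toℕ-i₁ toℕ-j₁ toℕ-i₂ toℕ-j₂
  with C ← probeColumns q∈
  with refl ← toℕ-injective (trans toℕ-j₁ (sym (ProbeColumns.toℕ-col₁ C)))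
     | refl ← toℕ-injective (trans toℕ-j₂ (sym (ProbeColumns.toℕ-col₂ C)))
  = safe-sets , cop-house
  where open SafeSets C i₁ i₂ toℕ-i₁ toℕ-i₂
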